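{- Let $\mathbb{V}=U\oplus W$ be an $n$-dimensional vector space over the field $\mathbb{F}_2$, where $U$ and $W$ are nonzero subspaces and $n\geq 4$. Then the clique number of the direct sum graph satisfies $\omega(\Gamma_{U\oplus W}(\mathbb{V}))=2^{n-2}$.
   Context: Let $\dim U=r$, $\dim W=s$, $r+s=n$. Fix a basis $\{\alpha_1,\dots,\alpha_r\}$ of $U$ and a basis $\{\beta_1,\dots,\beta_s\}$ of $W$; every $x\in\mathbb{V}$ is written uniquely as $x=\sum_i a_i\alpha_i+\sum_j b_j\beta_j$. The direct sum graph $\Gamma_{U\oplus W}(\mathbb{V})$ is the simple graph whose vertex set is $\{x=u+w: u\in U, w\in W, u\neq 0, w\neq 0\}$, in which two distinct vertices $x,y$ are adjacent iff there is an index $i$ such that the coefficient of $\alpha_i$ is nonzero in both $x$ and $y$, and there is an index $j$ such that the coefficient of $\beta_j$ is nonzero in both $x$ and $y$. The clique number is the maximum number of pairwise adjacent vertices. -}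

module Defs where

open import Data.Bool using (Bool; true; false)
open import Data.Nat using (ℕ; _≤_)
open import Data.Fin using (Fin)
open import Data.Vec using (Vec; lookup)
open import Data.Product using (_×_; proj₁; proj₂; ∃; ∃-syntax)
open import Data.List using (List; length)
open import Data.List.Relation.Unary.All using (All)
open import Data.List.Relation.Unary.AllPairs using (AllPairs)
open import Relation.Binary.PropositionalEquality using (_≡_; _≢_)

-- Scalars of 𝔽₂ are represented by Bool (true = 1, false = 0).
-- A vector of V = U ⊕ W (dim U = r, dim W = s) is given by its coordinate
-- vectors (a₁..a_r) w.r.t. the basis α of U and (b₁..b_s) w.r.t. the basis β of W.
Vect : ℕ → ℕ → Set
Vect r s = Vec Bool r × Vec Bool s

NonZeroVec : ∀ {k} → Vec Bool k → Set
NonZeroVec {k} a = ∃[ i ] (lookup a i ≡ true)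

IsVertex : ∀ {r s} → Vect r s → Set
IsVertex x = NonZeroVec (proj₁ x) × NonZeroVec (proj₂ x)

CommonSupport : ∀ {k} → Vec Bool k → Vec Bool k → Set
CommonSupport {k} a a' = ∃[ i ] (lookup a i ≡ true × lookup a' i ≡ true)

Adjacent : ∀ {r s} → Vect r s → Vect r s → Set
Adjacent x y = x ≢ y × CommonSupport (proj₁ x) (proj₁ y) × CommonSupport (proj₂ x) (proj₂ y)

IsClique : ∀ {r s} → List (Vect r s) → Set
IsClique xs = All IsVertex xs × AllPairs Adjacent xs

CliqueNumber : ℕ → ℕ → ℕ → Set
CliqueNumber r s m =
  (∃[ xs ] (IsClique {r} {s} xs × length xs ≡ m)) ×
  (∀ (xs : List (Vect r s)) → IsClique xs → length xs ≤ m)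

-- Identify each coordinate block a ∈ 𝔽₂^r with its complement 1 + a. Adjacent
-- vertices are never complementary in a block, since complementary vectors have
-- disjoint supports, and distinct vertices that agree up to complement in both
-- blocks are complementary in one of them. So a clique injects into
-- 𝔽₂^r/⟨1⟩ × 𝔽₂^s/⟨1⟩, which has 2^(r-1) · 2^(s-1) = 2^(n-2) elements.
-- Conversely, the vertices whose first α- and first β-coordinates are both 1
-- form a clique of exactly that size.
module Submission where

open import Defs
open import Data.Bool using (Bool; true; false; not)
open import Data.Bool.Properties using (not-involutive; not-¬)
open import Data.Empty using (⊥; ⊥-elim)
open import Data.Fin using (zero)
open import Data.List using (List; []; _∷_; length; map; _++_; cartesianProduct)
open import Data.List.Membership.Propositional using (_∈_)
open import Data.List.Membership.Propositional.Properties
  using (∈-map⁺; ∈-map⁻; ∈-++⁺ˡ; ∈-++⁺ʳ; ∈-cartesianProduct⁺)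
open import Data.List.Properties using (length-map; length-++; length-removeAt′)
open import Data.List.Relation.Binary.Subset.Propositional using (_⊆_)
open import Data.List.Relation.Unary.All using (All; []; _∷_)
import Data.List.Relation.Unary.All as All
import Data.List.Relation.Unary.AllPairs as AllPairs
import Data.List.Relation.Unary.AllPairs.Properties as AllPairsₚ
open import Data.List.Relation.Unary.Any using (here; there; index; _─_)
open import Data.List.Relation.Unary.Unique.Propositional using (Unique; []; _∷_)
import Data.List.Relation.Unary.Unique.Propositional.Properties as Uniqueₚ
open import Data.Nat using (ℕ; suc; _≤_; _+_; _*_; _∸_; _^_; z≤n; s≤s)
open import Data.Nat.Properties using (+-identityʳ; +-suc; ^-distribˡ-+-*)
open import Data.Product using (_×_; _,_)
import Data.Product as Product
open import Data.Product.Properties using (,-injective)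
open import Data.Sum using (_⊎_; inj₁; inj₂)
open import Data.Vec using (Vec; []; _∷_)
import Data.Vec as Vec
open import Data.Vec.Properties using (lookup-map; map-∘; map-cong; map-id; ∷-injectiveʳ)
open import Function using (id; _∘_)
open import Relation.Nullary using (¬_)
open import Relation.Binary.PropositionalEquality

module _ {A : Set} where

  ∈-─ : ∀ {x y : A} {ys} (x∈ys : x ∈ ys) → y ∈ ys → y ≢ x → y ∈ (ys ─ x∈ys)
  ∈-─ (here refl)  (here refl)  y≢x = ⊥-elim (y≢x refl)
  ∈-─ (here refl)  (there y∈ys) _   = y∈ys
  ∈-─ (there _)    (here refl)  _   = here refl
  ∈-─ (there x∈ys) (there y∈ys) y≢x = there (∈-─ x∈ys y∈ys y≢x)

  Unique-⊆⇒length≤ : ∀ {xs ys : List A} → Unique xs → xs ⊆ ys → length xs ≤ length ys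
  Unique-⊆⇒length≤ [] _ = z≤n
  Unique-⊆⇒length≤ {x ∷ xs} {ys} (x∉xs ∷ xs!) xs⊆ys =
    subst (suc (length xs) ≤_) (sym (length-removeAt′ ys (index x∈ys)))
      (s≤s (Unique-⊆⇒length≤ xs! λ z∈xs →
        ∈-─ x∈ys (xs⊆ys (there z∈xs)) λ z≡x → All.lookup x∉xs z∈xs (sym z≡x)))
    where x∈ys = xs⊆ys (here refl)

  length-cartesianProduct : ∀ {B : Set} (xs : List A) (ys : List B) →
                            length (cartesianProduct xs ys) ≡ length xs * length ys
  length-cartesianProduct []       ys = refl
  length-cartesianProduct (x ∷ xs) ys = begin
    length (map (x ,_) ys ++ cartesianProduct xs ys)       ≡⟨ length-++ (map (x ,_) ys) ⟩
    length (map (x ,_) ys) + length (cartesianProduct xs ys)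
      ≡⟨ cong₂ _+_ (length-map (x ,_) ys) (length-cartesianProduct xs ys) ⟩
    length ys + length xs * length ys                      ∎
    where open ≡-Reasoning

allVecs : ∀ k → List (Vec Bool k)
allVecs 0       = [] ∷ []
allVecs (suc k) = map (true ∷_) (allVecs k) ++ map (false ∷_) (allVecs k)

length-allVecs : ∀ k → length (allVecs k) ≡ 2 ^ k
length-allVecs 0       = refl
length-allVecs (suc k) = begin
  length (map (true ∷_) (allVecs k) ++ map (false ∷_) (allVecs k))
    ≡⟨ length-++ (map (true ∷_) (allVecs k)) ⟩
  length (map (true ∷_) (allVecs k)) + length (map (false ∷_) (allVecs k))
    ≡⟨ cong₂ _+_ (length-map (true ∷_) (allVecs k)) (length-map (false ∷_) (allVecs k)) ⟩
  length (allVecs k) + length (allVecs k)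
    ≡⟨ cong (λ m → m + m) (length-allVecs k) ⟩
  2 ^ k + 2 ^ k
    ≡⟨ cong (2 ^ k +_) (sym (+-identityʳ (2 ^ k))) ⟩
  2 ^ suc k ∎
  where open ≡-Reasoning

∈-allVecs : ∀ {k} (v : Vec Bool k) → v ∈ allVecs k
∈-allVecs []           = here refl
∈-allVecs (true ∷ v)   = ∈-++⁺ˡ (∈-map⁺ (true ∷_) (∈-allVecs v))
∈-allVecs {suc k} (false ∷ v) =
  ∈-++⁺ʳ (map (true ∷_) (allVecs k)) (∈-map⁺ (false ∷_) (∈-allVecs v))

allVecs-unique : ∀ k → Unique (allVecs k)
allVecs-unique 0       = [] ∷ []
allVecs-unique (suc k) =
  Uniqueₚ.++⁺ (Uniqueₚ.map⁺ ∷-injectiveʳ (allVecs-unique k))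
              (Uniqueₚ.map⁺ ∷-injectiveʳ (allVecs-unique k))
              heads-differ
  where
  heads-differ : ∀ {v} → v ∈ map (true ∷_) (allVecs k) × v ∈ map (false ∷_) (allVecs k) → ⊥
  heads-differ (p , q) with ∈-map⁻ (true ∷_) p | ∈-map⁻ (false ∷_) q
  ... | _ , _ , refl | _ , _ , ()

allVects : ∀ r s → List (Vect r s)
allVects r s = cartesianProduct (allVecs r) (allVecs s)

length-allVects : ∀ r s → length (allVects r s) ≡ 2 ^ r * 2 ^ s
length-allVects r s = trans (length-cartesianProduct (allVecs r) (allVecs s))
                            (cong₂ _*_ (length-allVecs r) (length-allVecs s))

∈-allVects : ∀ {r s} (x : Vect r s) → x ∈ allVects r s
∈-allVects (a , b) = ∈-cartesianProduct⁺ (∈-allVecs a) (∈-allVecs b)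

allVects-unique : ∀ r s → Unique (allVects r s)
allVects-unique r s = Uniqueₚ.cartesianProduct⁺ (allVecs-unique r) (allVecs-unique s)

complement : ∀ {k} → Vec Bool k → Vec Bool k
complement = Vec.map not

complement-involutive : ∀ {k} (a : Vec Bool k) → complement (complement a) ≡ a
complement-involutive a = begin
  Vec.map not (Vec.map not a) ≡⟨ map-∘ not not a ⟨
  Vec.map (not ∘ not) a       ≡⟨ map-cong not-involutive a ⟩
  Vec.map id a                ≡⟨ map-id a ⟩
  a                           ∎
  where open ≡-Reasoning

complement-injective : ∀ {k} {a b : Vec Bool k} → complement a ≡ complement b → a ≡ b
complement-injective {a = a} {b} eq = begin
  a                         ≡⟨ complement-involutive a ⟨
  complement (complement a) ≡⟨ cong complement eq ⟩
  complement (complement b) ≡⟨ complement-involutive b ⟩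
  b                         ∎
  where open ≡-Reasoning

complement-disjoint : ∀ {k} (a : Vec Bool k) → ¬ CommonSupport a (complement a)
complement-disjoint a (i , aᵢ≡1 , ¬aᵢ≡1) =
  not-¬ (sym aᵢ≡1) (sym (trans (sym (lookup-map i not a)) ¬aᵢ≡1))

-- The tail of the representative of {a, complement a} with first coordinate false.
reduce : ∀ {k} → Vec Bool (suc k) → Vec Bool k
reduce (false ∷ a) = a
reduce (true  ∷ a) = complement a

reduce-injective-up-to-complement : ∀ {k} (a b : Vec Bool (suc k)) →
  reduce a ≡ reduce b → a ≡ b ⊎ b ≡ complement a
reduce-injective-up-to-complement (false ∷ a) (false ∷ b) refl = inj₁ refl
reduce-injective-up-to-complement (true  ∷ a) (true  ∷ b) eq   =
  inj₁ (cong (true ∷_) (complement-injective eq))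
reduce-injective-up-to-complement (false ∷ a) (true  ∷ b) eq   =
  inj₂ (cong (true ∷_) (trans (sym (complement-involutive b)) (cong complement (sym eq))))
reduce-injective-up-to-complement (true  ∷ a) (false ∷ b) eq   =
  inj₂ (cong (false ∷_) (sym eq))

module _ {r s : ℕ} where

  reducePair : Vect (suc r) (suc s) → Vect r s
  reducePair = Product.map reduce reduce

  adjacent⇒reducePair-≢ : ∀ {x y} → Adjacent x y → reducePair x ≢ reducePair y
  adjacent⇒reducePair-≢ {a , b} {a′ , b′} (x≢y , αs , βs) eq
    with reduce-injective-up-to-complement a a′ (Product.proj₁ (,-injective eq))
       | reduce-injective-up-to-complement b b′ (Product.proj₂ (,-injective eq))
  ... | inj₁ refl | inj₁ refl = x≢y refl
  ... | inj₂ refl | _         = complement-disjoint a αs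
  ... | inj₁ _    | inj₂ refl = complement-disjoint b βs

  clique-length≤ : ∀ {xs} → IsClique xs → length xs ≤ 2 ^ r * 2 ^ s
  clique-length≤ {xs} (_ , adjacent) =
    subst₂ _≤_ (length-map reducePair xs) (length-allVects r s)
      (Unique-⊆⇒length≤ (AllPairsₚ.map⁺ (AllPairs.map adjacent⇒reducePair-≢ adjacent))
                        (λ {z} _ → ∈-allVects z))

  leadingOnes : Vect r s → Vect (suc r) (suc s)
  leadingOnes = Product.map (true ∷_) (true ∷_)

  leadingOnes-injective : ∀ {x y} → leadingOnes x ≡ leadingOnes y → x ≡ y
  leadingOnes-injective {a , b} {a′ , b′} eq with ,-injective eq
  ... | refl , refl = refl

  leadingOnes-clique : ∀ {xs} → Unique xs → IsClique (map leadingOnes xs)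
  leadingOnes-clique {xs} xs! = vertices xs , AllPairsₚ.map⁺ (AllPairs.map adjacent xs!)
    where
    vertices : ∀ xs → All IsVertex (map leadingOnes xs)
    vertices []       = []
    vertices (_ ∷ xs) = ((zero , refl) , (zero , refl)) ∷ vertices xs

    adjacent : ∀ {x y} → x ≢ y → Adjacent (leadingOnes x) (leadingOnes y)
    adjacent x≢y = x≢y ∘ leadingOnes-injective , (zero , refl , refl) , (zero , refl , refl)

cliqueNumber : ∀ r s → CliqueNumber (suc r) (suc s) (2 ^ r * 2 ^ s)
cliqueNumber r s =
  (map leadingOnes (allVects r s) ,
   leadingOnes-clique (allVects-unique r s) ,
   trans (length-map leadingOnes (allVects r s)) (length-allVects r s)) ,
  λ _ → clique-length≤

corollary4p6 : (n r s : ℕ) → 1 ≤ r → 1 ≤ s → r + s ≡ n → 4 ≤ n →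
    CliqueNumber r s (2 ^ (n ∸ 2))
corollary4p6 .(suc r + suc s) (suc r) (suc s) _ _ refl _ =
  subst (CliqueNumber (suc r) (suc s)) (sym exponent) (cliqueNumber r s)
  where
  exponent : 2 ^ (suc r + suc s ∸ 2) ≡ 2 ^ r * 2 ^ s
  exponent = trans (cong (λ m → 2 ^ (m ∸ 1)) (+-suc r s)) (^-distribˡ-+-* 2 r s)
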